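{- Let $n\geq m\geq3$ be odd integers and let $0<d<n$ be coprime to $n$. Then there exist two $C_n$-factors of $C_m[n]$ which between them exactly cover the differences $\pm d$.
   Context: $C_m[n]$ has vertex set $\mathbb{Z}_m\times\mathbb{Z}_n$ (vertex $(x,i)$ written $x_i$), with $x_i$ adjacent to $y_j$ iff $y=x\pm1$. A $C_n$-factor is a spanning subgraph all of whose components are $n$-cycles. A set of cycle factors of $C_m[n]$ covers a set $D\subseteq\mathbb{Z}_n$ if for every $e\in D$ all edges $x_i(x+1)_{i+e}$ ($x\in\mathbb{Z}_m$, $i\in\mathbb{Z}_n$) appear in some cycle of the factors; it exactly covers $D$ if moreover every edge of the factors is of this form. -}

module Defs where

open import Data.Nat using (ℕ; zero; suc; _∸_)
open import Data.Fin using (Fin; zero; suc)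
open import Data.Maybe using (Maybe; just; nothing; maybe)
import Data.Maybe as Maybe
open import Data.Product using (Σ; _×_; _,_; proj₁; proj₂; ∃; ∃-syntax)
open import Data.Sum using (_⊎_)
open import Function using (id)
open import Relation.Binary.PropositionalEquality using (_≡_)

-- Cyclic arithmetic on Fin n, read as ℤ_n (i ↦ i+1 mod n).
-- step i = just (i+1) unless i is the last element.
step : ∀ {n} → Fin n → Maybe (Fin n)
step {suc zero} zero = nothing
step {suc (suc n)} zero = just (suc zero)
step {suc (suc n)} (suc i) = Maybe.map suc (step i)

next : ∀ {n} → Fin n → Fin n
next {suc n} i = maybe id zero (step i)

addMod : ∀ {n} → ℕ → Fin n → Fin n
addMod zero i = i
addMod (suc e) i = next (addMod e i)

-- Vertices of C_m[n]: x_i = (x , i) ∈ ℤ_m × ℤ_n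
Vertex : ℕ → ℕ → Set
Vertex m n = Fin m × Fin n

Adj : ∀ {m n} → Vertex m n → Vertex m n → Set
Adj (x , i) (y , j) = next x ≡ y ⊎ next y ≡ x

record CnFactor (m n : ℕ) : Set where
  field
    k        : ℕ
    cyc      : Fin k → Fin n → Vertex m n
    spanning : ∀ (v : Vertex m n) → ∃[ c ] ∃[ p ] cyc c p ≡ v
    disjoint : ∀ c p c′ p′ → cyc c p ≡ cyc c′ p′ → (c ≡ c′ × p ≡ p′)
    edges    : ∀ c p → Adj (cyc c p) (cyc c (next p))

open CnFactor public

EdgeIn : ∀ {m n} → CnFactor m n → Vertex m n → Vertex m n → Set
EdgeIn F u v = ∃[ c ] ∃[ p ]
  ((cyc F c p ≡ u × cyc F c (next p) ≡ v) ⊎ (cyc F c p ≡ v × cyc F c (next p) ≡ u))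

HasDiff : ∀ {m n} → ℕ → Vertex m n → Vertex m n → Set
HasDiff e (x , i) (y , j) = next x ≡ y × addMod e i ≡ j

EdgeWithDiffIn : ∀ {m n} → (ℕ → Set) → Vertex m n → Vertex m n → Set
EdgeWithDiffIn D u v = ∃[ e ] (D e × (HasDiff e u v ⊎ HasDiff e v u))

-- Two cycle factors F₁, F₂ of C_m[n] exactly cover D ⊆ ℤ_n
-- (D given as a predicate on ℕ, elements read mod n).
ExactlyCover : ∀ {m n} → CnFactor m n → CnFactor m n → (ℕ → Set) → Set
ExactlyCover {m} {n} F₁ F₂ D =
  (∀ e → D e → ∀ (x : Fin m) (i : Fin n) →
     EdgeIn F₁ (x , i) (next x , addMod e i) ⊎ EdgeIn F₂ (x , i) (next x , addMod e i))
  × (∀ c p → EdgeWithDiffIn D (cyc F₁ c p) (cyc F₁ c (next p)))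
  × (∀ c p → EdgeWithDiffIn D (cyc F₂ c p) (cyc F₂ c (next p)))

-- the difference set {d , -d} ⊆ ℤ_n, with -d represented by n ∸ d
PlusMinus : ℕ → ℕ → ℕ → Set
PlusMinus n d e = e ≡ d ⊎ e ≡ n ∸ d

module Submission where

-- A walk X on the cycle ℤ_m of length n, moving ±1 at every step and
-- returning to its start, lifts to a C_n-factor of C_m[n] with m cycles:
-- cycle c visits the vertex (c + X p)_(p·d) at position p ∈ ℤ_n.  Since d is
-- invertible modulo n, position p ↦ column p·d is a bijection, so the cycles
-- are disjoint and spanning; a step up of X gives an edge of difference d,
-- a step down an edge of difference -d.  The mirror image -X steps down
-- exactly where X steps up, so the factors of X and -X together contain every
-- edge x_i (x+1)_(i±d), and nothing else.  A suitable walk exists when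
-- m ≤ n and m + n = 2h: the tent 0, 1, …, h, h-1, …, 2h - n = m ≡ 0.

open import Defs
open import Data.Nat using (ℕ; _≤_; _<_)
open import Data.Nat.Divisibility using (_∣_)
open import Data.Nat.Coprimality using (Coprime)
open import Data.Product using (Σ; _×_; ∃; ∃-syntax)
open import Relation.Nullary using (¬_)

open import Data.Nat using (zero; suc; _+_; _*_; _∸_; NonZero; _≤?_; z≤n)
open import Data.Nat.Properties
open import Data.Nat.DivMod
open import Data.Nat.Divisibility using (divides)
open import Data.Nat.Coprimality using (coprime-Bézout)
open import Data.Nat.GCD using (module Bézout)
open import Data.Nat.Tactic.RingSolver using (solve-∀)
open import Data.Fin as Fin using (Fin; toℕ)
open import Data.Fin.Properties using (toℕ-injective; toℕ-fromℕ<; toℕ<n)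
open import Data.Maybe using (just; nothing)
import Data.Maybe as Maybe
open import Data.Product using (_,_; proj₁; proj₂)
open import Data.Sum using (_⊎_; inj₁; inj₂)
open import Data.Empty using (⊥-elim)
open import Relation.Nullary using (yes; no)
open import Relation.Binary.Bundles using (Setoid)
open import Relation.Binary.PropositionalEquality
import Relation.Binary.Reasoning.Setoid as SetoidReasoning

infix 4 _≡_[mod_]
record _≡_[mod_] (a b K : ℕ) .{{_ : NonZero K}} : Set where
  constructor same-remainder
  field remainders : a % K ≡ b % K

module _ {K : ℕ} .{{_ : NonZero K}} where

  ≡⇒mod : ∀ {a b} → a ≡ b → a ≡ b [mod K ]
  ≡⇒mod a≡b = same-remainder (cong (_% K) a≡b)

  mod-refl : ∀ a → a ≡ a [mod K ]
  mod-refl a = ≡⇒mod refl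

  mod-sym : ∀ {a b} → a ≡ b [mod K ] → b ≡ a [mod K ]
  mod-sym (same-remainder r) = same-remainder (sym r)

  mod-trans : ∀ {a b c} → a ≡ b [mod K ] → b ≡ c [mod K ] → a ≡ c [mod K ]
  mod-trans (same-remainder r) (same-remainder s) = same-remainder (trans r s)

  mod-setoid : Setoid _ _
  mod-setoid = record
    { Carrier = ℕ
    ; _≈_ = λ a b → a ≡ b [mod K ]
    ; isEquivalence = record { refl = mod-refl _ ; sym = mod-sym ; trans = mod-trans }
    }

module ModReasoning (K : ℕ) .{{_ : NonZero K}} = SetoidReasoning (mod-setoid {K})

module _ {K : ℕ} .{{_ : NonZero K}} where

  +-cong-mod : ∀ {a b c e} → a ≡ b [mod K ] → c ≡ e [mod K ] → a + c ≡ b + e [mod K ]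
  +-cong-mod {a} {b} {c} {e} (same-remainder a≡b) (same-remainder c≡e) = same-remainder (begin
    (a + c) % K            ≡⟨ %-distribˡ-+ a c K ⟩
    (a % K + c % K) % K    ≡⟨ cong₂ (λ x y → (x + y) % K) a≡b c≡e ⟩
    (b % K + e % K) % K    ≡⟨ %-distribˡ-+ b e K ⟨
    (b + e) % K            ∎)
    where open ≡-Reasoning

  *-cong-mod : ∀ {a b c e} → a ≡ b [mod K ] → c ≡ e [mod K ] → a * c ≡ b * e [mod K ]
  *-cong-mod {a} {b} {c} {e} (same-remainder a≡b) (same-remainder c≡e) = same-remainder (begin
    (a * c) % K            ≡⟨ %-distribˡ-* a c K ⟩
    (a % K * (c % K)) % K  ≡⟨ cong₂ (λ x y → (x * y) % K) a≡b c≡e ⟩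
    (b % K * (e % K)) % K  ≡⟨ %-distribˡ-* b e K ⟨
    (b * e) % K            ∎)
    where open ≡-Reasoning

  %-mod : ∀ a → a % K ≡ a [mod K ]
  %-mod a = same-remainder (m%n%n≡m%n a K)

  +-multiple-mod : ∀ a t → a + t * K ≡ a [mod K ]
  +-multiple-mod a t = same-remainder ([m+kn]%n≡m%n a t K)

  mod-unique : ∀ {a b} → a < K → b < K → a ≡ b [mod K ] → a ≡ b
  mod-unique a<K b<K (same-remainder a≡b) =
    trans (sym (m<n⇒m%n≡m a<K)) (trans a≡b (m<n⇒m%n≡m b<K))

  *-cancelʳ-mod : ∀ {d u a b} → u * d ≡ 1 [mod K ] → a * d ≡ b * d [mod K ] → a ≡ b [mod K ]
  *-cancelʳ-mod {d} {u} {a} {b} ud≡1 ad≡bd = begin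
    a              ≈⟨ undo a ⟨
    a * d * u      ≈⟨ *-cong-mod ad≡bd (mod-refl u) ⟩
    b * d * u      ≈⟨ undo b ⟩
    b              ∎
    where
    open ModReasoning K
    reassociate : ∀ x d u → x * d * u ≡ x * (u * d)
    reassociate = solve-∀
    undo : ∀ x → x * d * u ≡ x [mod K ]
    undo x = begin
      x * d * u    ≡⟨ reassociate x d u ⟩
      x * (u * d)  ≈⟨ *-cong-mod (mod-refl x) ud≡1 ⟩
      x * 1        ≡⟨ *-identityʳ x ⟩
      x            ∎

+-cancelʳ-mod : ∀ {k a b y} → a + y ≡ b + y [mod suc k ] → a ≡ b [mod suc k ]
+-cancelʳ-mod {k} {a} {b} {y} a+y≡b+y = begin
  a                      ≈⟨ absorb a ⟨
  a + y + k * y          ≈⟨ +-cong-mod a+y≡b+y (mod-refl (k * y)) ⟩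
  b + y + k * y          ≈⟨ absorb b ⟩
  b                      ∎
  where
  open ModReasoning (suc k)
  regroup : ∀ x y k → x + y + k * y ≡ x + y * suc k
  regroup = solve-∀
  absorb : ∀ x → x + y + k * y ≡ x [mod suc k ]
  absorb x = mod-trans (≡⇒mod (regroup x y k)) (+-multiple-mod x y)

inverse-mod : ∀ {n d} → Coprime d (suc n) → ∃[ u ] u * d ≡ 1 [mod suc n ]
inverse-mod {n} {d} cop with coprime-Bézout cop
... | Bézout.+- x y 1+yN≡xd = x , (begin
  x * d            ≡⟨ 1+yN≡xd ⟨
  1 + y * suc n    ≈⟨ +-multiple-mod 1 y ⟩
  1                ∎)
  where open ModReasoning (suc n)
... | Bézout.-+ x y 1+xd≡yN = n * x , (begin
  n * x * d                  ≈⟨ +-multiple-mod (n * x * d) 1 ⟨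
  n * x * d + 1 * suc n      ≡⟨ regroup n x d ⟩
  1 + n * (1 + x * d)        ≡⟨ cong (λ z → 1 + n * z) 1+xd≡yN ⟩
  1 + n * (y * suc n)        ≡⟨ cong (1 +_) (*-assoc n y (suc n)) ⟨
  1 + n * y * suc n          ≈⟨ +-multiple-mod 1 (n * y) ⟩
  1                          ∎)
  where
  open ModReasoning (suc n)
  regroup : ∀ n x d → n * x * d + 1 * suc n ≡ 1 + n * (1 + x * d)
  regroup = solve-∀

step-cases : ∀ {n} (i : Fin (suc n)) →
  (toℕ i ≡ n × step i ≡ nothing) ⊎ (∃[ j ] step i ≡ just j × toℕ j ≡ suc (toℕ i))
step-cases {zero} Fin.zero = inj₁ (refl , refl)
step-cases {suc n} Fin.zero = inj₂ (Fin.suc Fin.zero , refl , refl)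
step-cases {suc n} (Fin.suc i) with step-cases i
... | inj₁ (i≡n , none) = inj₁ (cong suc i≡n , cong (Maybe.map Fin.suc) none)
... | inj₂ (j , some , j≡1+i) = inj₂ (Fin.suc j , cong (Maybe.map Fin.suc) some , cong suc j≡1+i)

toℕ-next : ∀ {n} (i : Fin (suc n)) → toℕ (next i) ≡ suc (toℕ i) % suc n
toℕ-next {n} i with step-cases i
... | inj₁ (i≡n , none) rewrite none | i≡n = sym (n%n≡0 (suc n))
... | inj₂ (j , some , j≡1+i) rewrite some =
  trans j≡1+i (sym (m<n⇒m%n≡m (subst (_< suc n) j≡1+i (toℕ<n j))))

toℕ-next-mod : ∀ {n} (i : Fin (suc n)) → toℕ (next i) ≡ suc (toℕ i) [mod suc n ]
toℕ-next-mod i = mod-trans (≡⇒mod (toℕ-next i)) (%-mod _)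

-- The residue class of a natural number, as an element of Fin (suc n).
-- It is used only through toℕ-residue, hence kept opaque.
opaque
  residue : ∀ {n} → ℕ → Fin (suc n)
  residue {n} a = a mod suc n

  toℕ-residue : ∀ {n} a → toℕ (residue {n} a) ≡ a % suc n
  toℕ-residue a = toℕ-fromℕ< _

toℕ-residue-mod : ∀ {n} a → toℕ (residue {n} a) ≡ a [mod suc n ]
toℕ-residue-mod a = mod-trans (≡⇒mod (toℕ-residue a)) (%-mod a)

residue-cong : ∀ {n a b} → a ≡ b [mod suc n ] → residue {n} a ≡ residue b
residue-cong {a = a} {b} (same-remainder a≡b) =
  toℕ-injective (trans (toℕ-residue a) (trans a≡b (sym (toℕ-residue b))))

residue-injective : ∀ {n a b} → residue {n} a ≡ residue b → a ≡ b [mod suc n ]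
residue-injective {a = a} {b} eq =
  same-remainder (trans (sym (toℕ-residue a)) (trans (cong toℕ eq) (toℕ-residue b)))

residue-toℕ : ∀ {n} (i : Fin (suc n)) → residue (toℕ i) ≡ i
residue-toℕ i = toℕ-injective (trans (toℕ-residue (toℕ i)) (m<n⇒m%n≡m (toℕ<n i)))

residue-of : ∀ {n a} {i : Fin (suc n)} → toℕ i ≡ a [mod suc n ] → i ≡ residue a
residue-of {i = i} i≡a = trans (sym (residue-toℕ i)) (residue-cong i≡a)

next-residue : ∀ {n} a → next (residue {n} a) ≡ residue (suc a)
next-residue {n} a = residue-of (begin
  toℕ (next (residue a))      ≈⟨ toℕ-next-mod (residue a) ⟩
  suc (toℕ (residue a))       ≈⟨ +-cong-mod (mod-refl 1) (toℕ-residue-mod a) ⟩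
  suc a                       ∎)
  where open ModReasoning (suc n)

addMod-residue : ∀ {n} e a → addMod e (residue {n} a) ≡ residue (a + e)
addMod-residue zero a = cong residue (sym (+-identityʳ a))
addMod-residue (suc e) a = begin
  next (addMod e (residue a))   ≡⟨ cong next (addMod-residue e a) ⟩
  next (residue (a + e))        ≡⟨ next-residue (a + e) ⟩
  residue (suc (a + e))         ≡⟨ cong residue (+-suc a e) ⟨
  residue (a + suc e)           ∎
  where open ≡-Reasoning

-- A height function X : ℕ → ℕ, read modulo suc m, is a walk on the cycle
-- ℤ_(suc m).  At time P it steps up or down when X (suc P) ≡ X P ± 1.
Up : ℕ → (ℕ → ℕ) → ℕ → Set
Up m X P = suc (X P) ≡ X (suc P) [mod suc m ]

Down : ℕ → (ℕ → ℕ) → ℕ → Set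
Down m X P = suc (X (suc P)) ≡ X P [mod suc m ]

record ClosedWalk (m N : ℕ) (X : ℕ → ℕ) : Set where
  field
    closes : X N ≡ X 0 [mod suc m ]
    moves  : ∀ P → P < N → Up m X P ⊎ Down m X P

-- The mirror image P ↦ -X P of a walk; m ≡ -1 modulo suc m.
mirror : ℕ → (ℕ → ℕ) → ℕ → ℕ
mirror m X P = m * X P

negate-step : ∀ {m a b} → suc a ≡ b [mod suc m ] → suc (m * b) ≡ m * a [mod suc m ]
negate-step {m} {a} {b} 1+a≡b = begin
  suc (m * b)           ≈⟨ +-cong-mod (mod-refl 1) (*-cong-mod (mod-refl m) 1+a≡b) ⟨
  suc (m * suc a)       ≡⟨ regroup m a ⟩
  m * a + 1 * suc m     ≈⟨ +-multiple-mod (m * a) 1 ⟩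
  m * a                 ∎
  where
  open ModReasoning (suc m)
  regroup : ∀ m a → suc (m * suc a) ≡ m * a + 1 * suc m
  regroup = solve-∀

mirror-walk : ∀ {m N X} → ClosedWalk m N X → ClosedWalk m N (mirror m X)
mirror-walk {m} {N} {X} W = record
  { closes = *-cong-mod (mod-refl m) closes
  ; moves  = λ P P<N → flip (moves P P<N)
  }
  where
  open ClosedWalk W
  flip : ∀ {P} → Up m X P ⊎ Down m X P → Up m (mirror m X) P ⊎ Down m (mirror m X) P
  flip (inj₁ up)   = inj₂ (negate-step up)
  flip (inj₂ down) = inj₁ (negate-step down)

tent : ℕ → ℕ → ℕ
tent h P with P ≤? h
... | yes _ = P
... | no  _ = h + h ∸ P

tent-start : ∀ h → tent h 0 ≡ 0
tent-start h with 0 ≤? h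
... | yes _ = refl
... | no 0≰h = ⊥-elim (0≰h z≤n)

tent-step : ∀ h P → P < h + h →
  suc (tent h P) ≡ tent h (suc P) ⊎ suc (tent h (suc P)) ≡ tent h P
tent-step h P P<2h with P ≤? h | suc P ≤? h
... | yes _   | yes _    = inj₁ refl
... | yes P≤h | no 1+P≰h = inj₂ (begin
  suc (h + h ∸ suc P)   ≡⟨ +-∸-assoc 1 P<2h ⟨
  h + h ∸ P             ≡⟨ cong (h + h ∸_) P≡h ⟩
  h + h ∸ h             ≡⟨ m+n∸n≡m h h ⟩
  h                     ≡⟨ P≡h ⟨
  P                     ∎)
  where
  open ≡-Reasoning
  P≡h : P ≡ h
  P≡h = ≤-antisym P≤h (≤-pred (≰⇒> 1+P≰h))
... | no P≰h  | yes 1+P≤h = ⊥-elim (P≰h (≤-trans (n≤1+n P) 1+P≤h))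
... | no _    | no _      = inj₂ (sym (+-∸-assoc 1 P<2h))

tent-end : ∀ {h M N} → M ≤ N → h + h ≡ N + M → tent h N ≡ M
tent-end {h} {M} {N} M≤N 2h≡N+M with N ≤? h
... | yes N≤h = ≤-antisym N≤M M≤N
  where
  N≤M : N ≤ M
  N≤M = +-cancelˡ-≤ N N M (≤-trans (+-mono-≤ N≤h N≤h) (≤-reflexive 2h≡N+M))
... | no _ = trans (cong (_∸ N) 2h≡N+M) (m+n∸m≡n N M)

tent-walk : ∀ h {m N} → suc m ≤ N → h + h ≡ N + suc m → ClosedWalk m N (tent h)
tent-walk h {m} {N} M≤N 2h≡N+M = record
  { closes = begin
      tent h N      ≡⟨ tent-end M≤N 2h≡N+M ⟩
      suc m         ≈⟨ same-remainder (n%n≡0 (suc m)) ⟩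
      0             ≡⟨ tent-start h ⟨
      tent h 0      ∎
  ; moves = λ P P<N → moves (tent-step h P (≤-trans P<N N≤2h))
  }
  where
  open ModReasoning (suc m)
  N≤2h : N ≤ h + h
  N≤2h = ≤-trans (m≤m+n N (suc m)) (≤-reflexive (sym 2h≡N+M))
  moves : ∀ {P} → suc (tent h P) ≡ tent h (suc P) ⊎ suc (tent h (suc P)) ≡ tent h P →
          Up m (tent h) P ⊎ Down m (tent h) P
  moves (inj₁ up)   = inj₁ (≡⇒mod up)
  moves (inj₂ down) = inj₂ (≡⇒mod down)

module Lift (m n d u : ℕ) (d≤N : d ≤ suc n) (ud≡1 : u * d ≡ 1 [mod suc n ]) where

  M N : ℕ
  M = suc m
  N = suc n

  column : Fin N → Fin N
  column p = residue (toℕ p * d)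

  position : Fin N → Fin N
  position i = residue (toℕ i * u)

  column-position : ∀ i → column (position i) ≡ i
  column-position i = sym (residue-of (mod-sym (begin
    toℕ (position i) * d     ≈⟨ *-cong-mod (toℕ-residue-mod (toℕ i * u)) (mod-refl d) ⟩
    toℕ i * u * d            ≡⟨ *-assoc (toℕ i) u d ⟩
    toℕ i * (u * d)          ≈⟨ *-cong-mod (mod-refl (toℕ i)) ud≡1 ⟩
    toℕ i * 1                ≡⟨ *-identityʳ (toℕ i) ⟩
    toℕ i                    ∎)))
    where open ModReasoning N

  -- Distinct positions lie in distinct columns, since d is invertible.
  column-injective : ∀ {p q} → column p ≡ column q → p ≡ q
  column-injective {p} {q} eq = toℕ-injective
    (mod-unique (toℕ<n p) (toℕ<n q) (*-cancelʳ-mod {u = u} ud≡1 (residue-injective eq)))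

  column-next : ∀ p → addMod d (column p) ≡ column (next p)
  column-next p = trans (addMod-residue d (toℕ p * d)) (residue-cong (begin
    toℕ p * d + d            ≡⟨ +-comm (toℕ p * d) d ⟩
    suc (toℕ p) * d          ≈⟨ *-cong-mod (toℕ-next-mod p) (mod-refl d) ⟨
    toℕ (next p) * d         ∎))
    where open ModReasoning N

  column-prev : ∀ p → addMod (N ∸ d) (column (next p)) ≡ column p
  column-prev p = trans (addMod-residue (N ∸ d) (toℕ (next p) * d)) (residue-cong (begin
    toℕ (next p) * d + (N ∸ d)     ≈⟨ +-cong-mod (*-cong-mod (toℕ-next-mod p) (mod-refl d)) (mod-refl (N ∸ d)) ⟩
    d + toℕ p * d + (N ∸ d)        ≡⟨ regroup d (toℕ p * d) (N ∸ d) ⟩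
    toℕ p * d + (d + (N ∸ d))      ≡⟨ cong (toℕ p * d +_) (m+[n∸m]≡n d≤N) ⟩
    toℕ p * d + N                  ≡⟨ cong (toℕ p * d +_) (*-identityˡ N) ⟨
    toℕ p * d + 1 * N              ≈⟨ +-multiple-mod (toℕ p * d) 1 ⟩
    toℕ p * d                      ∎))
    where
    open ModReasoning N
    regroup : ∀ a b c → a + b + c ≡ b + (a + c)
    regroup = solve-∀

  previous : Fin N → Fin N
  previous p = residue (toℕ p + n)

  next-previous : ∀ p → next (previous p) ≡ p
  next-previous p = begin
    next (residue (toℕ p + n))     ≡⟨ next-residue (toℕ p + n) ⟩
    residue (suc (toℕ p + n))      ≡⟨ residue-cong wrap ⟩
    residue (toℕ p)                ≡⟨ residue-toℕ p ⟩
    p                              ∎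
    where
    open ≡-Reasoning
    regroup : ∀ p n → suc (p + n) ≡ p + 1 * suc n
    regroup = solve-∀
    wrap : suc (toℕ p + n) ≡ toℕ p [mod N ]
    wrap = mod-trans (≡⇒mod (regroup (toℕ p) n)) (+-multiple-mod (toℕ p) 1)

  module Factor (X : ℕ → ℕ) (W : ClosedWalk m N X) where
    open ClosedWalk W

    row : Fin M → Fin N → Fin M
    row c p = residue (toℕ c + X (toℕ p))

    vertex : Fin M → Fin N → Vertex M N
    vertex c p = row c p , column p

    -- Since the walk closes up, its height after position p is that at next p.
    height-next : ∀ p → X (toℕ (next p)) ≡ X (suc (toℕ p)) [mod M ]
    height-next p with m≤n⇒m<n∨m≡n (toℕ<n p)
    ... | inj₁ 1+p<N = ≡⇒mod (cong X (trans (toℕ-next p) (m<n⇒m%n≡m 1+p<N)))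
    ... | inj₂ 1+p≡N = begin
      X (toℕ (next p))   ≡⟨ cong X (trans (toℕ-next p) (trans (cong (_% N) 1+p≡N) (n%n≡0 N))) ⟩
      X 0                ≈⟨ closes ⟨
      X N                ≡⟨ cong X 1+p≡N ⟨
      X (suc (toℕ p))    ∎
      where open ModReasoning M

    next-row : ∀ c p q → suc (X (toℕ p)) ≡ X (toℕ q) [mod M ] → next (row c p) ≡ row c q
    next-row c p q up = trans (next-residue (toℕ c + X (toℕ p))) (residue-cong (begin
      suc (toℕ c + X (toℕ p))    ≡⟨ +-suc (toℕ c) (X (toℕ p)) ⟨
      toℕ c + suc (X (toℕ p))    ≈⟨ +-cong-mod (mod-refl (toℕ c)) up ⟩
      toℕ c + X (toℕ q)          ∎))
      where open ModReasoning M

    up-edge : ∀ c p → Up m X (toℕ p) → next (row c p) ≡ row c (next p)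
    up-edge c p up = next-row c p (next p) (mod-trans up (mod-sym (height-next p)))

    down-edge : ∀ c p → Down m X (toℕ p) → next (row c (next p)) ≡ row c p
    down-edge c p down =
      next-row c (next p) p (mod-trans (+-cong-mod (mod-refl 1) (height-next p)) down)

    cycle-through : Fin M → Fin N → Fin M
    cycle-through x p = residue (toℕ x + m * X (toℕ p))

    row-cycle-through : ∀ x p → row (cycle-through x p) p ≡ x
    row-cycle-through x p = sym (residue-of (mod-sym (begin
      toℕ (cycle-through x p) + X (toℕ p)    ≈⟨ +-cong-mod (toℕ-residue-mod (toℕ x + m * X (toℕ p))) (mod-refl (X (toℕ p))) ⟩
      toℕ x + m * X (toℕ p) + X (toℕ p)      ≡⟨ regroup (toℕ x) m (X (toℕ p)) ⟩
      toℕ x + X (toℕ p) * M                  ≈⟨ +-multiple-mod (toℕ x) (X (toℕ p)) ⟩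
      toℕ x                                  ∎)))
      where
      open ModReasoning M
      regroup : ∀ x m h → x + m * h + h ≡ x + h * suc m
      regroup = solve-∀

    row-injective : ∀ {c c′} p → row c p ≡ row c′ p → c ≡ c′
    row-injective {c} {c′} p eq = toℕ-injective
      (mod-unique (toℕ<n c) (toℕ<n c′) (+-cancelʳ-mod (residue-injective eq)))

    vertex-through : ∀ x i → vertex (cycle-through x (position i)) (position i) ≡ (x , i)
    vertex-through x i = cong₂ _,_ (row-cycle-through x (position i)) (column-position i)

    disjoint-cycles : ∀ c p c′ p′ → vertex c p ≡ vertex c′ p′ → c ≡ c′ × p ≡ p′
    disjoint-cycles c p c′ p′ eq with column-injective {p} {p′} (cong proj₂ eq)
    ... | refl = row-injective p (cong proj₁ eq) , refl

    step-up : ∀ c p → Up m X (toℕ p) →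
      vertex c (next p) ≡ (next (row c p) , addMod d (column p))
    step-up c p up = cong₂ _,_ (sym (up-edge c p up)) (sym (column-next p))

    step-down : ∀ c p → Down m X (toℕ p) →
      vertex c p ≡ (next (row c (next p)) , addMod (N ∸ d) (column (next p)))
    step-down c p down = cong₂ _,_ (sym (down-edge c p down)) (sym (column-prev p))

    factor : CnFactor M N
    factor = record
      { k        = M
      ; cyc      = vertex
      ; spanning = λ { (x , i) → cycle-through x (position i) , position i , vertex-through x i }
      ; disjoint = disjoint-cycles
      ; edges    = λ c p → edge c p (moves (toℕ p) (toℕ<n p))
      }
      where
      edge : ∀ c p → Up m X (toℕ p) ⊎ Down m X (toℕ p) → Adj (vertex c p) (vertex c (next p))
      edge c p (inj₁ up)   = inj₁ (up-edge c p up)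
      edge c p (inj₂ down) = inj₂ (down-edge c p down)

    exact : ∀ c p → EdgeWithDiffIn (PlusMinus N d) (vertex c p) (vertex c (next p))
    exact c p with moves (toℕ p) (toℕ<n p)
    ... | inj₁ up   = d , inj₁ refl , inj₁ (up-edge c p up , column-next p)
    ... | inj₂ down = N ∸ d , inj₂ refl , inj₂ (down-edge c p down , column-prev p)

    covers-up : ∀ x i → Up m X (toℕ (position i)) →
      EdgeIn factor (x , i) (next x , addMod d i)
    covers-up x i up = c , p , inj₁ (at , trans (step-up c p up) (cong shift at))
      where
      p : Fin N
      p = position i
      c : Fin M
      c = cycle-through x p
      at : vertex c p ≡ (x , i)
      at = vertex-through x i
      shift : Vertex M N → Vertex M N
      shift (y , j) = next y , addMod d j

    covers-down : ∀ x i → Down m X (toℕ (previous (position i))) →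
      EdgeIn factor (x , i) (next x , addMod (N ∸ d) i)
    covers-down x i down = c , q , inj₂ (trans (step-down c q down) (cong shift at) , at)
      where
      q : Fin N
      q = previous (position i)
      c : Fin M
      c = cycle-through x (position i)
      at : vertex c (next q) ≡ (x , i)
      at = trans (cong (vertex c) (next-previous (position i))) (vertex-through x i)
      shift : Vertex M N → Vertex M N
      shift (y , j) = next y , addMod (N ∸ d) j

  -- A closed walk and its mirror image lift to two C_N-factors exactly covering
  -- ±d: at each position one of them steps up and the other steps down.
  mirrored-cover : ∀ {X} → ClosedWalk m N X →
    ∃[ F₁ ] ∃[ F₂ ] ExactlyCover {M} {N} F₁ F₂ (PlusMinus N d)
  mirrored-cover {X} W = F.factor , F̄.factor , cover , F.exact , F̄.exact
    where
    module F = Factor X W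
    module F̄ = Factor (mirror m X) (mirror-walk W)
    open ClosedWalk W
    cover : ∀ e → PlusMinus N d e → ∀ x i →
      EdgeIn F.factor (x , i) (next x , addMod e i) ⊎ EdgeIn F̄.factor (x , i) (next x , addMod e i)
    cover e (inj₁ refl) x i with moves (toℕ (position i)) (toℕ<n (position i))
    ... | inj₁ up   = inj₁ (F.covers-up x i up)
    ... | inj₂ down = inj₂ (F̄.covers-up x i (negate-step down))
    cover e (inj₂ refl) x i with moves (toℕ (previous (position i))) (toℕ<n (previous (position i)))
    ... | inj₁ up   = inj₂ (F̄.covers-down x i (negate-step up))
    ... | inj₂ down = inj₁ (F.covers-down x i down)

odd-minus-two : ∀ {m} → ¬ (2 ∣ suc (suc m)) → ¬ (2 ∣ m)
odd-minus-two m+2-odd (divides q m≡q*2) = m+2-odd (divides (suc q) (cong (2 +_) m≡q*2))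

odd-half : ∀ {m} → ¬ (2 ∣ m) → ∃[ a ] m ≡ suc (a + a)
odd-half {zero} m-odd = ⊥-elim (m-odd (divides 0 refl))
odd-half {suc zero} _ = 0 , refl
odd-half {suc (suc m)} m+2-odd with odd-half (odd-minus-two m+2-odd)
... | a , m≡2a+1 = suc a , cong (2 +_) (trans m≡2a+1 (sym (+-suc a a)))

odd-sum-half : ∀ {m n} → ¬ (2 ∣ m) → ¬ (2 ∣ n) → ∃[ h ] h + h ≡ n + m
odd-sum-half m-odd n-odd with odd-half m-odd | odd-half n-odd
... | a , refl | b , refl = suc (a + b) , regroup a b
  where
  regroup : ∀ a b → suc (a + b) + suc (a + b) ≡ suc (b + b) + suc (a + a)
  regroup = solve-∀

lemma2p7 : (m n d : ℕ) → ¬ (2 ∣ m) → ¬ (2 ∣ n) → 3 ≤ m → m ≤ n →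
    0 < d → d < n → Coprime d n →
    ∃[ F₁ ] ∃[ F₂ ] ExactlyCover {m} {n} F₁ F₂ (PlusMinus n d)
lemma2p7 zero _ _ m-odd _ _ _ _ _ _ = ⊥-elim (m-odd (divides 0 refl))
lemma2p7 (suc m) zero _ _ _ _ () _ _ _
lemma2p7 (suc m) (suc n) d m-odd n-odd _ M≤N _ d<N d-coprime
  with inverse-mod d-coprime | odd-sum-half m-odd n-odd
... | u , ud≡1 | h , 2h≡N+M =
  Lift.mirrored-cover m n d u (<⇒≤ d<N) ud≡1 (tent-walk h M≤N 2h≡N+M)
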